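{- Let $\mathbf L=(L,\vee,\wedge)$ be a lattice and $S$ a non-empty subset of $L$ such that $\bigwedge S$ and $\bigvee S$ exist. Then $P_S(\mathbf L)=P_{\{\bigwedge S,\bigvee S\}}(\mathbf L)$.
   Context: For a lattice $\mathbf L$ and $T\subseteq L$, $P_T(\mathbf L):=\{(x,y)\in L^2\mid x\wedge y\leq z\leq x\vee y\text{ for all }z\in T\}$. -}

module Defs where

open import Level using (Level; _⊔_)
open import Data.Product using (_×_; _,_)
open import Data.Sum using (_⊎_)
open import Relation.Unary using (Pred; _∈_; _⊆_)
open import Relation.Binary.PropositionalEquality using (_≡_)
open import Relation.Binary.Lattice using (Lattice)

module _ {c ℓ₁ ℓ₂ : Level} (𝐋 : Lattice c ℓ₁ ℓ₂) where
  open Lattice 𝐋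

  IsInfimum : {ℓ : Level} → Pred Carrier ℓ → Carrier → Set (c ⊔ ℓ ⊔ ℓ₂)
  IsInfimum S m = (∀ z → z ∈ S → m ≤ z) × (∀ y → (∀ z → z ∈ S → y ≤ z) → y ≤ m)

  IsSupremum : {ℓ : Level} → Pred Carrier ℓ → Carrier → Set (c ⊔ ℓ ⊔ ℓ₂)
  IsSupremum S M = (∀ z → z ∈ S → z ≤ M) × (∀ y → (∀ z → z ∈ S → z ≤ y) → M ≤ y)

  P : {ℓ : Level} → Pred Carrier ℓ → Pred (Carrier × Carrier) (c ⊔ ℓ ⊔ ℓ₂)
  P T (x , y) = ∀ z → z ∈ T → (x ∧ y ≤ z) × (z ≤ x ∨ y)

  Pair : Carrier → Carrier → Pred Carrier c
  Pair a b z = z ≡ a ⊎ z ≡ b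

{-# OPTIONS --safe #-}
-- Every bound x ∧ y ≤ z ≤ x ∨ y over z ∈ S is equivalent to the pair of
-- bounds at the extremes: x ∧ y is a lower bound of S iff it is below ⋀S,
-- and dually for ⋁S. The remaining bounds m ≤ x ∨ y and x ∧ y ≤ M go through
-- a witness s ∈ S, since m ≤ s ≤ x ∨ y and x ∧ y ≤ s ≤ M.
module Submission where

open import Defs
open import Level using (Level)
open import Data.Product using (_×_; ∃; _,_; proj₁; proj₂)
open import Data.Sum using (inj₁; inj₂)
open import Relation.Unary using (Pred; _∈_; _⊆_)
open import Relation.Binary.Lattice using (Lattice)
open import Relation.Binary.PropositionalEquality using (refl)

module _ {c ℓ₁ ℓ₂ ℓ : Level} (𝐋 : Lattice c ℓ₁ ℓ₂) {S : Pred (Lattice.Carrier 𝐋) ℓ} where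
  open Lattice 𝐋 hiding (refl)

  P⇒≤infimum : ∀ {m x y} → IsInfimum 𝐋 S m → (x , y) ∈ P 𝐋 S → x ∧ y ≤ m
  P⇒≤infimum (_ , greatest) xy∈P = greatest _ (λ z z∈S → proj₁ (xy∈P z z∈S))

  P⇒supremum≤ : ∀ {M x y} → IsSupremum 𝐋 S M → (x , y) ∈ P 𝐋 S → M ≤ x ∨ y
  P⇒supremum≤ (_ , least) xy∈P = least _ (λ z z∈S → proj₂ (xy∈P z z∈S))

  P⇒infimum≤ : ∀ {m x y} → ∃ (λ s → s ∈ S) → IsInfimum 𝐋 S m →
               (x , y) ∈ P 𝐋 S → m ≤ x ∨ y
  P⇒infimum≤ (s , s∈S) (lower , _) xy∈P = trans (lower s s∈S) (proj₂ (xy∈P s s∈S))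

  P⇒≤supremum : ∀ {M x y} → ∃ (λ s → s ∈ S) → IsSupremum 𝐋 S M →
                (x , y) ∈ P 𝐋 S → x ∧ y ≤ M
  P⇒≤supremum (s , s∈S) (upper , _) xy∈P = trans (proj₁ (xy∈P s s∈S)) (upper s s∈S)

  P-Pair⇒P-between : ∀ {a b} → (∀ z → z ∈ S → a ≤ z × z ≤ b) →
                     P 𝐋 (Pair 𝐋 a b) ⊆ P 𝐋 S
  P-Pair⇒P-between between xy∈P z z∈S =
    trans (proj₁ (xy∈P _ (inj₁ refl))) (proj₁ (between z z∈S)) ,
    trans (proj₂ (between z z∈S)) (proj₂ (xy∈P _ (inj₂ refl)))

lemma2 : {c ℓ₁ ℓ₂ ℓ : Level} (𝐋 : Lattice c ℓ₁ ℓ₂) (S : Pred (Lattice.Carrier 𝐋) ℓ)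
    → ∃ (λ s → s ∈ S)
    → (m M : Lattice.Carrier 𝐋)
    → IsInfimum 𝐋 S m
    → IsSupremum 𝐋 S M
    → (P 𝐋 S ⊆ P 𝐋 (Pair 𝐋 m M)) × (P 𝐋 (Pair 𝐋 m M) ⊆ P 𝐋 S)
lemma2 𝐋 S nonempty m M inf sup = P-S⊆P-Pair , P-Pair⇒P-between 𝐋 between
  where
  P-S⊆P-Pair : P 𝐋 S ⊆ P 𝐋 (Pair 𝐋 m M)
  P-S⊆P-Pair xy∈P .m (inj₁ refl) = P⇒≤infimum 𝐋 inf xy∈P , P⇒infimum≤ 𝐋 nonempty inf xy∈P
  P-S⊆P-Pair xy∈P .M (inj₂ refl) = P⇒≤supremum 𝐋 nonempty sup xy∈P , P⇒supremum≤ 𝐋 sup xy∈P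

  between : ∀ z → z ∈ S → Lattice._≤_ 𝐋 m z × Lattice._≤_ 𝐋 z M
  between z z∈S = proj₁ inf z z∈S , proj₁ sup z z∈S
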